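{- Let $M=\{1^{p_1},2^{p_2},\dots,n^{p_n}\}$ with $p_1,\dots,p_n$ positive integers. Then $$\sum_{T\in\mathcal{T}_M}x^{\mathsf{odd}^*(T)}y^{\mathsf{oe}^*(T)}z^{\mathsf{ee}^*(T)}=\sum_{T\in\mathcal{T}_M}x^{\mathsf{ee}^*(T)}y^{\mathsf{oe}^*(T)}z^{\mathsf{odd}^*(T)}.$$
   Context: A plane tree is a rooted tree in which the children of every node are linearly ordered. With $p=\sum p_i$, a weakly increasing tree on $M$ is a plane tree with $p+1$ nodes labeled by the elements of the multiset $M\cup\{0\}$ (with multiplicity) such that labels weakly increase along every root-to-leaf path and the labels of the children of each node weakly increase from left to right. $\mathcal{T}_M$ is the set of such trees. The degree of a node is its number of children; its level is its distance from the root (root at level $0$). $\mathsf{odd}^*(T)$ is the number of odd-degree nodes of $T$ other than the root; $\mathsf{oe}^*(T)$ (resp. $\mathsf{ee}^*(T)$) is the number of even-degree nodes other than the root lying on odd (resp. even) levels. -}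

module Defs where

open import Data.Nat using (ℕ; zero; suc; _+_; _≤_)
open import Data.Bool using (Bool; true; false; not; if_then_else_)
open import Data.Fin using (Fin; toℕ)
open import Data.List using (List; []; _∷_; _++_; map; replicate; concatMap; length)
open import Data.List.Relation.Unary.All using (All)
open import Data.List.Relation.Unary.Linked using (Linked)
open import Data.List.Relation.Binary.Permutation.Propositional using (_↭_)
open import Data.Product using (Σ; _×_)
open import Relation.Binary.PropositionalEquality using (_≡_)

data Tree : Set where
  node : ℕ → List Tree → Tree

label : Tree → ℕ
label (node l _) = l

children : Tree → List Tree
children (node _ cs) = cs

degree : Tree → ℕ
degree t = length (children t)

data WeaklyIncreasing : Tree → Set where
  wi : ∀ {l cs} →
       All (λ c → l ≤ label c) cs →
       Linked _≤_ (map label cs) →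
       All WeaklyIncreasing cs →
       WeaklyIncreasing (node l cs)

mutual
  labels : Tree → List ℕ
  labels (node l cs) = l ∷ labelsF cs

  labelsF : List Tree → List ℕ
  labelsF []       = []
  labelsF (t ∷ ts) = labels t ++ labelsF ts

-- the multiset M ∪ {0} with M = {1^{p_1}, …, n^{p_n}} (p indexed by Fin n,
-- p i is the multiplicity of the label toℕ i + 1)
multisetM0 : (n : ℕ) → (Fin n → ℕ) → List ℕ
multisetM0 n p = 0 ∷ concatMap (λ i → replicate (p i) (suc (toℕ i))) (Data.List.allFin n)
  where import Data.List

IsInTM : (n : ℕ) → (Fin n → ℕ) → Tree → Set
IsInTM n p T = WeaklyIncreasing T × (labels T ↭ multisetM0 n p)


isOdd : ℕ → Bool
isOdd zero    = false
isOdd (suc k) = not (isOdd k)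

mutual
  countAt : (ℕ → ℕ → Bool) → ℕ → Tree → ℕ
  countAt P d (node l cs) =
    (if P d (length cs) then 1 else 0) + countF P (suc d) cs

  countF : (ℕ → ℕ → Bool) → ℕ → List Tree → ℕ
  countF P d []       = 0
  countF P d (t ∷ ts) = countAt P d t + countF P d ts

countNonRoot : (ℕ → ℕ → Bool) → Tree → ℕ
countNonRoot P T = countF P 1 (children T)

odd* : Tree → ℕ
odd* = countNonRoot (λ lvl deg → isOdd deg)

oe* : Tree → ℕ
oe* = countNonRoot (λ lvl deg → if isOdd lvl then not (isOdd deg) else false)

ee* : Tree → ℕ
ee* = countNonRoot (λ lvl deg → if isOdd lvl then false else not (isOdd deg))

{-# OPTIONS --safe #-}
-- Read a plane forest as a binary tree whose two pointers are the first
-- child and the next sibling.  The involution Φ fixes the root and, at nodes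
-- selected by a four-state automaton (φ, σ₀, σ₁, σ₂) running down this binary
-- tree, exchanges the two pointers.  Exchanging pointers keeps every node
-- labelled at least as its binary parent, so weak increase and the label
-- multiset survive.  For the statistics, charge every node to the empty list
-- closing its list of children: the level parity and the degree parity of
-- the node can be read off the path to that empty list, and the automaton
-- moves them so that the weights x and z are exchanged while y is fixed.
module Submission where

open import Defs
open import Data.Bool using (Bool; true; false; not; _xor_; if_then_else_)
open import Data.Bool.Properties using (not-involutive; not-distribˡ-xor; not-distribʳ-xor; xor-identityʳ)
open import Data.Fin using (Fin)
open import Data.Irrelevant as Irrelevant using ()
open import Data.List using (List; []; _∷_; map; length)
open import Data.List.Relation.Binary.Permutation.Propositional using (_↭_; ↭-refl; ↭-trans; prep)
open import Data.List.Relation.Binary.Permutation.Propositional.Properties using (++-comm; ++⁺)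
open import Data.List.Relation.Unary.All as All using (All; []; _∷_)
open import Data.List.Relation.Unary.All.Properties using (map⁻)
open import Data.List.Relation.Unary.Linked as Linked using (Linked; [-]; _∷_)
open import Data.List.Relation.Unary.Linked.Properties using (Linked⇒All)
open import Data.Nat using (ℕ; suc; _+_; _≤_)
open import Data.Nat.Properties using (≤-refl; ≤-trans; +-assoc; +-comm; +-cancelʳ-≡)
open import Data.Product using (_×_; _,_; proj₁; proj₂; uncurry)
open import Data.Refinement using (Refinement; _,_; value-injective)
open import Data.Unit using (⊤; tt)
open import Function using (_∘_)
open import Function.Bundles using (_↔_; mk↔ₛ′)
open import Relation.Binary.PropositionalEquality using (_≡_; refl; sym; trans; cong; cong₂; module ≡-Reasoning)

module _ {A : Set} {P Q : A → Set} (f : A → A) (f-involutive : ∀ x → f (f x) ≡ x) where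

  involution⇒Refinement↔ : (∀ {x} → P x → Q (f x)) → (∀ {x} → Q x → P (f x)) →
                           Refinement A P ↔ Refinement A Q
  involution⇒Refinement↔ P⇒Q Q⇒P = mk↔ₛ′
    (λ { (x , px) → f x , Irrelevant.map P⇒Q px })
    (λ { (x , qx) → f x , Irrelevant.map Q⇒P qx })
    (λ { (x , _) → value-injective (f-involutive x) })
    (λ { (x , _) → value-injective (f-involutive x) })

mutual
  φ : List Tree → List Tree
  φ []               = []
  φ (node l cs ∷ ts) = node l (σ₀ cs) ∷ φ ts

  σ₀ : List Tree → List Tree
  σ₀ []               = []
  σ₀ (node l cs ∷ ts) = node l (σ₁ ts) ∷ σ₂ cs

  σ₁ : List Tree → List Tree
  σ₁ []               = []
  σ₁ (node l cs ∷ ts) = node l (σ₀ ts) ∷ φ cs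

  σ₂ : List Tree → List Tree
  σ₂ []               = []
  σ₂ (node l cs ∷ ts) = node l (φ ts) ∷ σ₀ cs

Φ : Tree → Tree
Φ (node r cs) = node r (φ cs)

mutual
  φ-involutive : ∀ F → φ (φ F) ≡ F
  φ-involutive []               = refl
  φ-involutive (node l cs ∷ ts) = cong₂ (λ cs′ ts′ → node l cs′ ∷ ts′) (σ₀-involutive cs) (φ-involutive ts)

  σ₀-involutive : ∀ F → σ₀ (σ₀ F) ≡ F
  σ₀-involutive []               = refl
  σ₀-involutive (node l cs ∷ ts) = cong₂ (λ cs′ ts′ → node l cs′ ∷ ts′) (σ₁-σ₂-inverse cs) (σ₂-σ₁-inverse ts)

  σ₁-σ₂-inverse : ∀ F → σ₁ (σ₂ F) ≡ F
  σ₁-σ₂-inverse []               = refl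
  σ₁-σ₂-inverse (node l cs ∷ ts) = cong₂ (λ cs′ ts′ → node l cs′ ∷ ts′) (σ₀-involutive cs) (φ-involutive ts)

  σ₂-σ₁-inverse : ∀ F → σ₂ (σ₁ F) ≡ F
  σ₂-σ₁-inverse []               = refl
  σ₂-σ₁-inverse (node l cs ∷ ts) = cong₂ (λ cs′ ts′ → node l cs′ ∷ ts′) (φ-involutive cs) (σ₀-involutive ts)

Φ-involutive : ∀ T → Φ (Φ T) ≡ T
Φ-involutive (node r cs) = cong (node r) (φ-involutive cs)

length-φ : ∀ F → length (φ F) ≡ length F
length-φ []              = refl
length-φ (node _ _ ∷ ts) = cong suc (length-φ ts)

mutual
  labelsF-φ : ∀ F → labelsF (φ F) ↭ labelsF F
  labelsF-φ []               = ↭-refl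
  labelsF-φ (node l cs ∷ ts) = prep l (++⁺ (labelsF-σ₀ cs) (labelsF-φ ts))

  labelsF-σ₀ : ∀ F → labelsF (σ₀ F) ↭ labelsF F
  labelsF-σ₀ []               = ↭-refl
  labelsF-σ₀ (node l cs ∷ ts) = prep l (↭-trans (++⁺ (labelsF-σ₁ ts) (labelsF-σ₂ cs)) (++-comm (labelsF ts) (labelsF cs)))

  labelsF-σ₁ : ∀ F → labelsF (σ₁ F) ↭ labelsF F
  labelsF-σ₁ []               = ↭-refl
  labelsF-σ₁ (node l cs ∷ ts) = prep l (↭-trans (++⁺ (labelsF-σ₀ ts) (labelsF-φ cs)) (++-comm (labelsF ts) (labelsF cs)))

  labelsF-σ₂ : ∀ F → labelsF (σ₂ F) ↭ labelsF F
  labelsF-σ₂ []               = ↭-refl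
  labelsF-σ₂ (node l cs ∷ ts) = prep l (↭-trans (++⁺ (labelsF-φ ts) (labelsF-σ₀ cs)) (++-comm (labelsF ts) (labelsF cs)))

labels-Φ : ∀ T → labels (Φ T) ↭ labels T
labels-Φ (node r cs) = prep r (labelsF-φ cs)

-- Heap order of the binary-tree view; b is the label of the binary parent.
IsHeap : ℕ → List Tree → Set
IsHeap b []               = ⊤
IsHeap b (node l cs ∷ ts) = b ≤ l × IsHeap l cs × IsHeap l ts

mutual
  heap-φ : ∀ {b} F → IsHeap b F → IsHeap b (φ F)
  heap-φ []               _                 = tt
  heap-φ (node l cs ∷ ts) (b≤l , hcs , hts) = b≤l , heap-σ₀ cs hcs , heap-φ ts hts

  heap-σ₀ : ∀ {b} F → IsHeap b F → IsHeap b (σ₀ F)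
  heap-σ₀ []               _                 = tt
  heap-σ₀ (node l cs ∷ ts) (b≤l , hcs , hts) = b≤l , heap-σ₁ ts hts , heap-σ₂ cs hcs

  heap-σ₁ : ∀ {b} F → IsHeap b F → IsHeap b (σ₁ F)
  heap-σ₁ []               _                 = tt
  heap-σ₁ (node l cs ∷ ts) (b≤l , hcs , hts) = b≤l , heap-σ₀ ts hts , heap-φ cs hcs

  heap-σ₂ : ∀ {b} F → IsHeap b F → IsHeap b (σ₂ F)
  heap-σ₂ []               _                 = tt
  heap-σ₂ (node l cs ∷ ts) (b≤l , hcs , hts) = b≤l , heap-φ ts hts , heap-σ₀ cs hcs

wi⁺ : ∀ {l cs} → Linked _≤_ (l ∷ map label cs) → All WeaklyIncreasing cs → WeaklyIncreasing (node l cs)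
wi⁺ lk ws = wi (map⁻ (All.tail (Linked⇒All ≤-trans ≤-refl lk))) (Linked.tail lk) ws

wi⁻ : ∀ {l cs} → WeaklyIncreasing (node l cs) → Linked _≤_ (l ∷ map label cs) × All WeaklyIncreasing cs
wi⁻ (wi []        _  ws) = [-] , ws
wi⁻ (wi (l≤c ∷ _) lk ws) = l≤c ∷ lk , ws

heap⁺ : ∀ {b} F → Linked _≤_ (b ∷ map label F) → All WeaklyIncreasing F → IsHeap b F
heap⁺ []               _  _        = tt
heap⁺ (node l cs ∷ ts) lk (w ∷ ws) =
  Linked.head lk , uncurry (heap⁺ cs) (wi⁻ w) , heap⁺ ts (Linked.tail lk) ws

heap⁻ : ∀ {b} F → IsHeap b F → Linked _≤_ (b ∷ map label F) × All WeaklyIncreasing F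
heap⁻ []               _                 = [-] , []
heap⁻ (node l cs ∷ ts) (b≤l , hcs , hts) =
  b≤l ∷ proj₁ (heap⁻ ts hts) , uncurry wi⁺ (heap⁻ cs hcs) ∷ proj₂ (heap⁻ ts hts)

Φ-weaklyIncreasing : ∀ T → WeaklyIncreasing T → WeaklyIncreasing (Φ T)
Φ-weaklyIncreasing (node r cs) w = uncurry wi⁺ (heap⁻ (φ cs) (heap-φ cs (uncurry (heap⁺ cs) (wi⁻ w))))

IsInTM-Φ : ∀ n p T → IsInTM n p T → IsInTM n p (Φ T)
IsInTM-Φ n p T (w , perm) = Φ-weaklyIncreasing T w , ↭-trans (labels-Φ T) perm

-- The exponents of x, y, z: nodes of odd degree, of even degree on an odd
-- level, and of even degree on an even level.
Stat : Set
Stat = ℕ × ℕ × ℕ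

_⊕_ : Stat → Stat → Stat
(a , b , c) ⊕ (d , e , f) = (a + d , b + e , c + f)

swap₁₃ : Stat → Stat
swap₁₃ (a , b , c) = (c , b , a)

⊕-comm : ∀ s t → s ⊕ t ≡ t ⊕ s
⊕-comm (a , b , c) (d , e , f) rewrite +-comm a d | +-comm b e | +-comm c f = refl

⊕-assoc : ∀ s t u → (s ⊕ t) ⊕ u ≡ s ⊕ (t ⊕ u)
⊕-assoc (a , b , c) (d , e , f) (g , h , i) rewrite +-assoc a d g | +-assoc b e h | +-assoc c f i = refl

⊕-cancelʳ : ∀ s t u → s ⊕ u ≡ t ⊕ u → s ≡ t
⊕-cancelʳ (a , b , c) (d , e , f) (g , h , i) eq =
  cong₂ _,_ (+-cancelʳ-≡ g a d (cong proj₁ eq))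
    (cong₂ _,_ (+-cancelʳ-≡ h b e (cong (proj₁ ∘ proj₂) eq)) (+-cancelʳ-≡ i c f (cong (proj₂ ∘ proj₂) eq)))

weight : Bool → Bool → Stat
weight oddLevel oddDegree =
  if oddDegree then (1 , 0 , 0) else if oddLevel then (0 , 1 , 0) else (0 , 0 , 1)

weight-indicators : ∀ lvl deg → weight lvl deg ≡
  ( (if deg then 1 else 0)
  , (if (if lvl then not deg else false) then 1 else 0)
  , (if (if lvl then false else not deg) then 1 else 0))
weight-indicators true  true  = refl
weight-indicators true  false = refl
weight-indicators false true  = refl
weight-indicators false false = refl

stat : (oddLevel : Bool) → List Tree → Stat
stat lvl []               = (0 , 0 , 0)
stat lvl (node _ cs ∷ ts) = (weight lvl (isOdd (length cs)) ⊕ stat (not lvl) cs) ⊕ stat lvl ts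

stat-countF : ∀ d F → stat (isOdd d) F ≡
  ( countF (λ lvl deg → isOdd deg) d F
  , countF (λ lvl deg → if isOdd lvl then not (isOdd deg) else false) d F
  , countF (λ lvl deg → if isOdd lvl then false else not (isOdd deg)) d F)
stat-countF d []               = refl
stat-countF d (node l cs ∷ ts)
  rewrite stat-countF (suc d) cs | stat-countF d ts | weight-indicators (isOdd d) (isOdd (length cs)) = refl

stats : Tree → Stat
stats T = (odd* T , oe* T , ee* T)

stats≡stat : ∀ T → stats T ≡ stat true (children T)
stats≡stat (node _ cs) = sym (stat-countF 1 cs)

-- Each node is charged to the empty list closing its children; oddPos is the
-- parity of the number of earlier siblings, so at that empty list it is the
-- parity of the node's degree.
closingStat : (oddLevel oddPos : Bool) → List Tree → Stat
closingStat lvl pos []               = weight (not lvl) pos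
closingStat lvl pos (node _ cs ∷ ts) = closingStat (not lvl) false cs ⊕ closingStat lvl (not pos) ts

⊕-interchange : ∀ s w t u → (s ⊕ w) ⊕ (t ⊕ u) ≡ ((w ⊕ s) ⊕ t) ⊕ u
⊕-interchange s w t u = begin
  (s ⊕ w) ⊕ (t ⊕ u)   ≡⟨ sym (⊕-assoc (s ⊕ w) t u) ⟩
  ((s ⊕ w) ⊕ t) ⊕ u   ≡⟨ cong (λ v → (v ⊕ t) ⊕ u) (⊕-comm s w) ⟩
  ((w ⊕ s) ⊕ t) ⊕ u   ∎
  where open ≡-Reasoning

closingStat≡stat : ∀ lvl pos F →
  closingStat lvl pos F ≡ stat lvl F ⊕ weight (not lvl) (pos xor isOdd (length F))
closingStat≡stat lvl pos []               = cong (weight (not lvl)) (sym (xor-identityʳ pos))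
closingStat≡stat lvl pos (node _ cs ∷ ts)
  rewrite closingStat≡stat (not lvl) false cs | closingStat≡stat lvl (not pos) ts | not-involutive lvl
        | sym (not-distribˡ-xor pos (isOdd (length ts))) | not-distribʳ-xor pos (isOdd (length ts)) =
  ⊕-interchange (stat (not lvl) cs) (weight lvl (isOdd (length cs))) (stat lvl ts) _

mutual
  closingStat-σ₀ : ∀ F → closingStat false false F ≡ swap₁₃ (closingStat false false (σ₀ F))
  closingStat-σ₀ []               = refl
  closingStat-σ₀ (node _ cs ∷ ts) =
    trans (⊕-comm (closingStat true false cs) _) (cong₂ _⊕_ (closingStat-σ₁ ts) (closingStat-σ₂ cs))

  closingStat-σ₁ : ∀ F → closingStat false true F ≡ swap₁₃ (closingStat true false (σ₁ F))
  closingStat-σ₁ []               = refl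
  closingStat-σ₁ (node _ cs ∷ ts) =
    trans (⊕-comm (closingStat true false cs) _) (cong₂ _⊕_ (closingStat-σ₀ ts) (closingStat-φ-even cs))

  closingStat-σ₂ : ∀ F → closingStat true false F ≡ swap₁₃ (closingStat false true (σ₂ F))
  closingStat-σ₂ []               = refl
  closingStat-σ₂ (node _ cs ∷ ts) =
    trans (⊕-comm (closingStat false false cs) _) (cong₂ _⊕_ (closingStat-φ-odd ts) (closingStat-σ₀ cs))

  closingStat-φ-odd : ∀ F → closingStat true true F ≡ swap₁₃ (closingStat true false (φ F))
  closingStat-φ-odd []               = refl
  closingStat-φ-odd (node _ cs ∷ ts) = cong₂ _⊕_ (closingStat-σ₀ cs) (closingStat-φ-even ts)

  closingStat-φ-even : ∀ F → closingStat true false F ≡ swap₁₃ (closingStat true true (φ F))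
  closingStat-φ-even []               = refl
  closingStat-φ-even (node _ cs ∷ ts) = cong₂ _⊕_ (closingStat-σ₀ cs) (closingStat-φ-odd ts)

swap₁₃-weight-even : ∀ deg → swap₁₃ (weight false (not deg)) ≡ weight false deg
swap₁₃-weight-even true  = refl
swap₁₃-weight-even false = refl

-- The closing empty list of the root's children carries the root's weight,
-- which the statistics exclude; it is cancelled on both sides.
stat-φ : ∀ F → stat true F ≡ swap₁₃ (stat true (φ F))
stat-φ F = ⊕-cancelʳ _ _ (weight false deg) (begin
  stat true F ⊕ weight false deg                             ≡⟨ sym (closingStat≡stat true false F) ⟩
  closingStat true false F                                   ≡⟨ closingStat-φ-even F ⟩
  swap₁₃ (closingStat true true (φ F))                       ≡⟨ cong swap₁₃ (closingStat≡stat true true (φ F)) ⟩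
  swap₁₃ (stat true (φ F) ⊕ weight false (not deg′))         ≡⟨ cong (λ k → swap₁₃ (stat true (φ F) ⊕ weight false (not (isOdd k)))) (length-φ F) ⟩
  swap₁₃ (stat true (φ F)) ⊕ swap₁₃ (weight false (not deg)) ≡⟨ cong (swap₁₃ (stat true (φ F)) ⊕_) (swap₁₃-weight-even deg) ⟩
  swap₁₃ (stat true (φ F)) ⊕ weight false deg                ∎)
  where
  open ≡-Reasoning
  deg deg′ : Bool
  deg  = isOdd (length F)
  deg′ = isOdd (length (φ F))

stats-Φ : ∀ T → stats T ≡ swap₁₃ (stats (Φ T))
stats-Φ (node r cs) = begin
  stats (node r cs)                ≡⟨ stats≡stat (node r cs) ⟩
  stat true cs                     ≡⟨ stat-φ cs ⟩
  swap₁₃ (stat true (φ cs))        ≡⟨ cong swap₁₃ (sym (stats≡stat (Φ (node r cs)))) ⟩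
  swap₁₃ (stats (Φ (node r cs)))   ∎
  where open ≡-Reasoning

odd*-Φ : ∀ T → odd* (Φ T) ≡ ee* T
odd*-Φ T = sym (cong (proj₂ ∘ proj₂) (stats-Φ T))

oe*-Φ : ∀ T → oe* (Φ T) ≡ oe* T
oe*-Φ T = sym (cong (proj₁ ∘ proj₂) (stats-Φ T))

ee*-Φ : ∀ T → ee* (Φ T) ≡ odd* T
ee*-Φ T = sym (cong proj₁ (stats-Φ T))

-- The involution Φ works for any multiset.
corollary2p3 : (n : ℕ) → 1 ≤ n → (p : Fin n → ℕ) → (∀ i → 1 ≤ p i) →
    (a b c : ℕ) →
    Refinement Tree (λ T → IsInTM n p T × (odd* T ≡ a) × (oe* T ≡ b) × (ee* T ≡ c))
    ↔ Refinement Tree (λ T → IsInTM n p T × (ee* T ≡ a) × (oe* T ≡ b) × (odd* T ≡ c))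
corollary2p3 n _ p _ a b c = involution⇒Refinement↔ Φ Φ-involutive forward backward
  where
  forward : ∀ {T} → IsInTM n p T × (odd* T ≡ a) × (oe* T ≡ b) × (ee* T ≡ c) →
            IsInTM n p (Φ T) × (ee* (Φ T) ≡ a) × (oe* (Φ T) ≡ b) × (odd* (Φ T) ≡ c)
  forward {T} (inTM , odd≡a , oe≡b , ee≡c) =
    IsInTM-Φ n p T inTM , trans (ee*-Φ T) odd≡a , trans (oe*-Φ T) oe≡b , trans (odd*-Φ T) ee≡c

  backward : ∀ {T} → IsInTM n p T × (ee* T ≡ a) × (oe* T ≡ b) × (odd* T ≡ c) →
             IsInTM n p (Φ T) × (odd* (Φ T) ≡ a) × (oe* (Φ T) ≡ b) × (ee* (Φ T) ≡ c)
  backward {T} (inTM , ee≡a , oe≡b , odd≡c) =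
    IsInTM-Φ n p T inTM , trans (odd*-Φ T) ee≡a , trans (oe*-Φ T) oe≡b , trans (ee*-Φ T) odd≡c
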